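{- (1) If $\forall\mathbf{HLJ}+(\mathrm{com})$ derives $\Gamma_1\Rightarrow\varphi_1\mid\cdots\mid\Gamma_n\Rightarrow\varphi_n$, then the universal closure of $\bigvee_{i=1}^{n}(\bigwedge\Gamma_i\to\varphi_i)$ is $\forall\mathbf{INT}+\mathsf{LIN}$-valid. (2) If $\forall\mathbf{HLJ}'+(\mathrm{com})$ derives $\Gamma_1\Rightarrow\Delta_1\mid\cdots\mid\Gamma_n\Rightarrow\Delta_n$, then the universal closure of $\bigvee_{i=1}^{n}(\bigwedge\Gamma_i\to\bigvee\Delta_i)$ is $\forall\mathbf{INT}+\mathsf{LIN}$-valid.
   Context: Formulas are first-order formulas built from atoms and $\bot$ with $\land,\lor,\to,\forall,\exists$. A sequent $\Gamma\Rightarrow\Delta$ consists of finite sequences of formulas; a hypersequent is a finite sequence of sequents $\Gamma_1\Rightarrow\Delta_1\mid\cdots\mid\Gamma_n\Rightarrow\Delta_n$; $G,H$ denote possibly empty hypersequents, $S,T$ sequents. An empty conjunction is $\top$, an empty disjunction is $\bot$. $\mathbf{HLK}$ has: axioms $\varphi\Rightarrow\varphi$, $\bot\Rightarrow\varphi$; external weakening (from $G$ infer $S\mid G$), contraction (from $S\mid S\mid G$ infer $S\mid G$), exchange (from $G\mid S\mid T\mid H$ infer $G\mid T\mid S\mid H$); internal weakening, contraction and exchange on either side of a component, with arbitrary side hypersequent $G$; cut: from $\Gamma_0\Rightarrow\Delta_0,\delta\mid G$ and $\delta,\Gamma_1\Rightarrow\Delta_1\mid G$ infer $\Gamma_0,\Gamma_1\Rightarrow\Delta_0,\Delta_1\mid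 G$; logical rules with side hypersequent $G$: from $\varphi_i,\Gamma\Rightarrow\Delta\mid G$ infer $\varphi_1\land\varphi_2,\Gamma\Rightarrow\Delta\mid G$; from $\Gamma\Rightarrow\Delta,\varphi_1\mid G$ and $\Gamma\Rightarrow\Delta,\varphi_2\mid G$ infer $\Gamma\Rightarrow\Delta,\varphi_1\land\varphi_2\mid G$; from $\varphi_1,\Gamma\Rightarrow\Delta\mid G$ and $\varphi_2,\Gamma\Rightarrow\Delta\mid G$ infer $\varphi_1\lor\varphi_2,\Gamma\Rightarrow\Delta\mid G$; from $\Gamma\Rightarrow\Delta,\varphi_i\mid G$ infer $\Gamma\Rightarrow\Delta,\varphi_1\lor\varphi_2\mid G$; from $\Gamma\Rightarrow\Delta,\varphi\mid G$ and $\psi,\Gamma\Rightarrow\Delta\mid G$ infer $\varphi\to\psi,\Gamma\Rightarrow\Delta\mid G$; from $\varphi,\Gamma\Rightarrow\Delta,\psi\mid G$ infer $\Gamma\Rightarrow\Delta,\varphi\to\psi\mid G$. $\mathbf{HLJ}'$ is $\mathbf{HLK}$ with the last rule replaced by: from $\varphi,\Gamma\Rightarrow\psi\mid G$ infer $\Gamma\Rightarrow\varphi\to\psi\mid G$. $\mathbf{HLJ}$ is $\mathbf{HLK}$ restricted to single-conclusion sequents (every succedent has at most one formula). $\forall\mathbf{HLJ}$ (resp. $\forall\mathbf{HLJ}'$) is $\mathbf{HLJ}$ (resp. $\mathbf{HLJ}'$) plus: from $[t/x]\varphi,\Gamma\Rightarrow\Delta\mid G$ infer $\forall x\varphi,\Gamma\Rightarrow\Delta\mid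 G$; from $\Gamma\Rightarrow\varphi$ infer $\Gamma\Rightarrow\forall x\varphi$ (single component, $x$ not free in $\Gamma$); from $\varphi,\Gamma\Rightarrow\Delta$ infer $\exists x\varphi,\Gamma\Rightarrow\Delta$ (single component, $x$ not free in $\Gamma,\Delta$); from $\Gamma\Rightarrow\Delta,[t/x]\psi\mid G$ infer $\Gamma\Rightarrow\Delta,\exists x\psi\mid G$. $(\mathrm{com})$: from $\Gamma,\Delta\Rightarrow\Theta\mid G$ and $\Gamma',\Delta'\Rightarrow\Theta'\mid G$ infer $\Gamma,\Delta'\Rightarrow\Theta\mid\Gamma',\Delta\Rightarrow\Theta'\mid G$. $\forall\mathbf{INT}+\mathsf{LIN}$ is intuitionistic predicate logic plus the schema $(\varphi\to\psi)\lor(\psi\to\varphi)$; "valid" means valid (equivalently provable) in this logic. -}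

module Defs where

open import Data.Nat using (ℕ; zero; suc; _≤_; _⊔_; _∸_)
open import Data.List using (List; []; _∷_; _++_; map; length; [_])
open import Data.List.Relation.Unary.All using (All)
open import Data.List.Membership.Propositional using (_∈_)
open import Data.Unit using (⊤)
open import Relation.Binary.PropositionalEquality using (_≡_)

data Term : Set where
  var : ℕ → Term
  fun : ℕ → List Term → Term

infixr 8 _∧ᶠ_
infixr 7 _∨ᶠ_
infixr 6 _⇒ᶠ_

data Formula : Set where
  atom : ℕ → List Term → Formula
  ⊥ᶠ   : Formula
  _∧ᶠ_ _∨ᶠ_ _⇒ᶠ_ : Formula → Formula → Formula
  ∀ᶠ ∃ᶠ : Formula → Formula            -- bind de Bruijn index 0

Subst : Set
Subst = ℕ → Term

mutual
  substT : Subst → Term → Term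
  substT σ (var n)    = σ n
  substT σ (fun f ts) = fun f (substTs σ ts)

  substTs : Subst → List Term → List Term
  substTs σ []       = []
  substTs σ (t ∷ ts) = substT σ t ∷ substTs σ ts

shiftT : Term → Term
shiftT = substT (λ n → var (suc n))

exts : Subst → Subst
exts σ zero    = var zero
exts σ (suc n) = shiftT (σ n)

substF : Subst → Formula → Formula
substF σ (atom p ts) = atom p (substTs σ ts)
substF σ ⊥ᶠ          = ⊥ᶠ
substF σ (φ ∧ᶠ ψ)    = substF σ φ ∧ᶠ substF σ ψ
substF σ (φ ∨ᶠ ψ)    = substF σ φ ∨ᶠ substF σ ψ
substF σ (φ ⇒ᶠ ψ)    = substF σ φ ⇒ᶠ substF σ ψ
substF σ (∀ᶠ φ)      = ∀ᶠ (substF (exts σ) φ)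
substF σ (∃ᶠ φ)      = ∃ᶠ (substF (exts σ) φ)

-- weakening: shift all free variables up by one (makes index 0 fresh)
shiftF : Formula → Formula
shiftF = substF (λ n → var (suc n))

_∷ₛ_ : Term → Subst → Subst
(t ∷ₛ σ) zero    = t
(t ∷ₛ σ) (suc n) = σ n

inst : Formula → Term → Formula
inst φ t = substF (t ∷ₛ var) φ

mutual
  fvT : Term → ℕ
  fvT (var n)    = suc n
  fvT (fun f ts) = fvTs ts

  fvTs : List Term → ℕ
  fvTs []       = 0
  fvTs (t ∷ ts) = fvT t ⊔ fvTs ts

-- fvF φ = least k such that every free index of φ is < k
fvF : Formula → ℕ
fvF (atom p ts) = fvTs ts
fvF ⊥ᶠ          = 0
fvF (φ ∧ᶠ ψ)    = fvF φ ⊔ fvF ψ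
fvF (φ ∨ᶠ ψ)    = fvF φ ⊔ fvF ψ
fvF (φ ⇒ᶠ ψ)    = fvF φ ⊔ fvF ψ
fvF (∀ᶠ φ)      = fvF φ ∸ 1
fvF (∃ᶠ φ)      = fvF φ ∸ 1

closeN : ℕ → Formula → Formula
closeN zero    φ = φ
closeN (suc k) φ = ∀ᶠ (closeN k φ)

closure : Formula → Formula
closure φ = closeN (fvF φ) φ

-- Big conjunction / disjunction (empty ∧ = ⊤ := ⊥ → ⊥, empty ∨ = ⊥)

⊤ᶠ : Formula
⊤ᶠ = ⊥ᶠ ⇒ᶠ ⊥ᶠ

⋀ : List Formula → Formula
⋀ []           = ⊤ᶠ
⋀ (φ ∷ [])     = φ
⋀ (φ ∷ ψ ∷ Γ)  = φ ∧ᶠ ⋀ (ψ ∷ Γ)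

⋁ : List Formula → Formula
⋁ []           = ⊥ᶠ
⋁ (φ ∷ [])     = φ
⋁ (φ ∷ ψ ∷ Γ)  = φ ∨ᶠ ⋁ (ψ ∷ Γ)

-- ∀INT + LIN : natural deduction for intuitionistic predicate logic
-- plus the schema (φ → ψ) ∨ (ψ → φ)

infix 2 _⊢_

data _⊢_ : List Formula → Formula → Set where
  hyp  : ∀ {Γ φ} → φ ∈ Γ → Γ ⊢ φ
  ⊥E   : ∀ {Γ φ} → Γ ⊢ ⊥ᶠ → Γ ⊢ φ
  ∧I   : ∀ {Γ φ ψ} → Γ ⊢ φ → Γ ⊢ ψ → Γ ⊢ φ ∧ᶠ ψ
  ∧E₁  : ∀ {Γ φ ψ} → Γ ⊢ φ ∧ᶠ ψ → Γ ⊢ φ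
  ∧E₂  : ∀ {Γ φ ψ} → Γ ⊢ φ ∧ᶠ ψ → Γ ⊢ ψ
  ∨I₁  : ∀ {Γ φ ψ} → Γ ⊢ φ → Γ ⊢ φ ∨ᶠ ψ
  ∨I₂  : ∀ {Γ φ ψ} → Γ ⊢ ψ → Γ ⊢ φ ∨ᶠ ψ
  ∨E   : ∀ {Γ φ ψ χ} → Γ ⊢ φ ∨ᶠ ψ → φ ∷ Γ ⊢ χ → ψ ∷ Γ ⊢ χ → Γ ⊢ χ
  ⇒I   : ∀ {Γ φ ψ} → φ ∷ Γ ⊢ ψ → Γ ⊢ φ ⇒ᶠ ψ
  ⇒E   : ∀ {Γ φ ψ} → Γ ⊢ φ ⇒ᶠ ψ → Γ ⊢ φ → Γ ⊢ ψ
  ∀I   : ∀ {Γ φ} → map shiftF Γ ⊢ φ → Γ ⊢ ∀ᶠ φ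
  ∀E   : ∀ {Γ φ} → Γ ⊢ ∀ᶠ φ → (t : Term) → Γ ⊢ inst φ t
  ∃I   : ∀ {Γ φ} (t : Term) → Γ ⊢ inst φ t → Γ ⊢ ∃ᶠ φ
  ∃E   : ∀ {Γ φ ψ} → Γ ⊢ ∃ᶠ φ → φ ∷ map shiftF Γ ⊢ shiftF ψ → Γ ⊢ ψ
  lin  : ∀ {Γ φ ψ} → Γ ⊢ (φ ⇒ᶠ ψ) ∨ᶠ (ψ ⇒ᶠ φ)

Valid : Formula → Set
Valid φ = [] ⊢ φ

infix 3 _⇒_
record Sequent : Set where
  constructor _⇒_
  field
    ante : List Formula
    succ : List Formula
open Sequent public

Hyper : Set
Hyper = List Sequent

-- which calculus: J = ∀HLJ (single-conclusion HLK), J' = ∀HLJ'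
data Calc : Set where
  J J' : Calc

SingleConc : Hyper → Set
SingleConc H = All (λ S → length (succ S) ≤ 1) H

-- side condition imposed on the conclusion of every rule/axiom:
-- in ∀HLJ every sequent occurring in a derivation is single-conclusion
Ok : Calc → Hyper → Set
Ok J  H = SingleConc H
Ok J' H = ⊤

-- Derivability in ∀HLJ + (com)  (c = J)  resp.  ∀HLJ' + (com)  (c = J').
-- The active component is written first, the side hypersequent G after it.
data Der (c : Calc) : Hyper → Set where
  ax   : ∀ {φ} → Ok c [ [ φ ] ⇒ [ φ ] ] → Der c [ [ φ ] ⇒ [ φ ] ]
  ax⊥  : ∀ {φ} → Ok c [ [ ⊥ᶠ ] ⇒ [ φ ] ] → Der c [ [ ⊥ᶠ ] ⇒ [ φ ] ]
  ew   : ∀ {S G} → Ok c (S ∷ G) → Der c G → Der c (S ∷ G)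
  ec   : ∀ {S G} → Ok c (S ∷ G) → Der c (S ∷ S ∷ G) → Der c (S ∷ G)
  ee   : ∀ {G S T H} → Ok c (G ++ T ∷ S ∷ H) →
         Der c (G ++ S ∷ T ∷ H) → Der c (G ++ T ∷ S ∷ H)
  wl   : ∀ {φ Γ Δ G} → Ok c ((φ ∷ Γ ⇒ Δ) ∷ G) →
         Der c ((Γ ⇒ Δ) ∷ G) → Der c ((φ ∷ Γ ⇒ Δ) ∷ G)
  wr   : ∀ {φ Γ Δ G} → Ok c ((Γ ⇒ Δ ++ [ φ ]) ∷ G) →
         Der c ((Γ ⇒ Δ) ∷ G) → Der c ((Γ ⇒ Δ ++ [ φ ]) ∷ G)
  cl   : ∀ {φ Γ Δ G} → Ok c ((φ ∷ Γ ⇒ Δ) ∷ G) →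
         Der c ((φ ∷ φ ∷ Γ ⇒ Δ) ∷ G) → Der c ((φ ∷ Γ ⇒ Δ) ∷ G)
  cr   : ∀ {φ Γ Δ G} → Ok c ((Γ ⇒ Δ ++ [ φ ]) ∷ G) →
         Der c ((Γ ⇒ Δ ++ φ ∷ φ ∷ []) ∷ G) → Der c ((Γ ⇒ Δ ++ [ φ ]) ∷ G)
  xl   : ∀ {φ ψ Γ Π Δ G} → Ok c ((Γ ++ ψ ∷ φ ∷ Π ⇒ Δ) ∷ G) →
         Der c ((Γ ++ φ ∷ ψ ∷ Π ⇒ Δ) ∷ G) → Der c ((Γ ++ ψ ∷ φ ∷ Π ⇒ Δ) ∷ G)
  xr   : ∀ {φ ψ Γ Δ Π G} → Ok c ((Γ ⇒ Δ ++ ψ ∷ φ ∷ Π) ∷ G) →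
         Der c ((Γ ⇒ Δ ++ φ ∷ ψ ∷ Π) ∷ G) → Der c ((Γ ⇒ Δ ++ ψ ∷ φ ∷ Π) ∷ G)
  cut  : ∀ {Γ₀ Δ₀ δ Γ₁ Δ₁ G} → Ok c ((Γ₀ ++ Γ₁ ⇒ Δ₀ ++ Δ₁) ∷ G) →
         Der c ((Γ₀ ⇒ Δ₀ ++ [ δ ]) ∷ G) → Der c ((δ ∷ Γ₁ ⇒ Δ₁) ∷ G) →
         Der c ((Γ₀ ++ Γ₁ ⇒ Δ₀ ++ Δ₁) ∷ G)
  ∧L₁  : ∀ {φ₁ φ₂ Γ Δ G} → Ok c ((φ₁ ∧ᶠ φ₂ ∷ Γ ⇒ Δ) ∷ G) →
         Der c ((φ₁ ∷ Γ ⇒ Δ) ∷ G) → Der c ((φ₁ ∧ᶠ φ₂ ∷ Γ ⇒ Δ) ∷ G)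
  ∧L₂  : ∀ {φ₁ φ₂ Γ Δ G} → Ok c ((φ₁ ∧ᶠ φ₂ ∷ Γ ⇒ Δ) ∷ G) →
         Der c ((φ₂ ∷ Γ ⇒ Δ) ∷ G) → Der c ((φ₁ ∧ᶠ φ₂ ∷ Γ ⇒ Δ) ∷ G)
  ∧R   : ∀ {φ₁ φ₂ Γ Δ G} → Ok c ((Γ ⇒ Δ ++ [ φ₁ ∧ᶠ φ₂ ]) ∷ G) →
         Der c ((Γ ⇒ Δ ++ [ φ₁ ]) ∷ G) → Der c ((Γ ⇒ Δ ++ [ φ₂ ]) ∷ G) →
         Der c ((Γ ⇒ Δ ++ [ φ₁ ∧ᶠ φ₂ ]) ∷ G)
  ∨L   : ∀ {φ₁ φ₂ Γ Δ G} → Ok c ((φ₁ ∨ᶠ φ₂ ∷ Γ ⇒ Δ) ∷ G) →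
         Der c ((φ₁ ∷ Γ ⇒ Δ) ∷ G) → Der c ((φ₂ ∷ Γ ⇒ Δ) ∷ G) →
         Der c ((φ₁ ∨ᶠ φ₂ ∷ Γ ⇒ Δ) ∷ G)
  ∨R₁  : ∀ {φ₁ φ₂ Γ Δ G} → Ok c ((Γ ⇒ Δ ++ [ φ₁ ∨ᶠ φ₂ ]) ∷ G) →
         Der c ((Γ ⇒ Δ ++ [ φ₁ ]) ∷ G) → Der c ((Γ ⇒ Δ ++ [ φ₁ ∨ᶠ φ₂ ]) ∷ G)
  ∨R₂  : ∀ {φ₁ φ₂ Γ Δ G} → Ok c ((Γ ⇒ Δ ++ [ φ₁ ∨ᶠ φ₂ ]) ∷ G) →
         Der c ((Γ ⇒ Δ ++ [ φ₂ ]) ∷ G) → Der c ((Γ ⇒ Δ ++ [ φ₁ ∨ᶠ φ₂ ]) ∷ G)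
  ⇒L   : ∀ {φ ψ Γ Δ G} → Ok c ((φ ⇒ᶠ ψ ∷ Γ ⇒ Δ) ∷ G) →
         Der c ((Γ ⇒ Δ ++ [ φ ]) ∷ G) → Der c ((ψ ∷ Γ ⇒ Δ) ∷ G) →
         Der c ((φ ⇒ᶠ ψ ∷ Γ ⇒ Δ) ∷ G)
  -- implication right: HLK form in ∀HLJ, restricted form in ∀HLJ'
  ⇒R   : ∀ {φ ψ Γ Δ G} → c ≡ J → Ok c ((Γ ⇒ Δ ++ [ φ ⇒ᶠ ψ ]) ∷ G) →
         Der c ((φ ∷ Γ ⇒ Δ ++ [ ψ ]) ∷ G) → Der c ((Γ ⇒ Δ ++ [ φ ⇒ᶠ ψ ]) ∷ G)
  ⇒R'  : ∀ {φ ψ Γ G} → c ≡ J' → Ok c ((Γ ⇒ [ φ ⇒ᶠ ψ ]) ∷ G) →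
         Der c ((φ ∷ Γ ⇒ [ ψ ]) ∷ G) → Der c ((Γ ⇒ [ φ ⇒ᶠ ψ ]) ∷ G)
  -- quantifier rules (eigenvariable = fresh index 0 after shifting)
  ∀L   : ∀ {φ Γ Δ G} (t : Term) → Ok c ((∀ᶠ φ ∷ Γ ⇒ Δ) ∷ G) →
         Der c ((inst φ t ∷ Γ ⇒ Δ) ∷ G) → Der c ((∀ᶠ φ ∷ Γ ⇒ Δ) ∷ G)
  ∀R   : ∀ {φ Γ} → Ok c [ Γ ⇒ [ ∀ᶠ φ ] ] →
         Der c [ map shiftF Γ ⇒ [ φ ] ] → Der c [ Γ ⇒ [ ∀ᶠ φ ] ]
  ∃L   : ∀ {φ Γ Δ} → Ok c [ ∃ᶠ φ ∷ Γ ⇒ Δ ] →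
         Der c [ φ ∷ map shiftF Γ ⇒ map shiftF Δ ] → Der c [ ∃ᶠ φ ∷ Γ ⇒ Δ ]
  ∃R   : ∀ {φ Γ Δ G} (t : Term) → Ok c ((Γ ⇒ Δ ++ [ ∃ᶠ φ ]) ∷ G) →
         Der c ((Γ ⇒ Δ ++ [ inst φ t ]) ∷ G) → Der c ((Γ ⇒ Δ ++ [ ∃ᶠ φ ]) ∷ G)
  com  : ∀ {Γ Δ Θ Γ' Δ' Θ' G} →
         Ok c ((Γ ++ Δ' ⇒ Θ) ∷ (Γ' ++ Δ ⇒ Θ') ∷ G) →
         Der c ((Γ ++ Δ ⇒ Θ) ∷ G) → Der c ((Γ' ++ Δ' ⇒ Θ') ∷ G) →
         Der c ((Γ ++ Δ' ⇒ Θ) ∷ (Γ' ++ Δ ⇒ Θ') ∷ G)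

{-# OPTIONS --safe #-}

-- Read a component Γ ⇒ Δ as ⋀ Γ → ⋁ Δ and a hypersequent as the disjunction of its
-- components. Each rule preserves intuitionistic derivability of this reading: a rule
-- acting on one component is sound for that component and passes through the
-- disjunction of the side hypersequent; ∀R and ∃L have no side hypersequent, so their
-- eigenvariable conditions are those of ∀I and ∃E. The one non-intuitionistic rule is
-- (com): by LIN either ⋀ Δ → ⋀ Δ' or ⋀ Δ' → ⋀ Δ, and in each case one premise alone
-- already yields one of the two new components. Since the reading of a derivable
-- hypersequent is derivable without assumptions, so is its universal closure.

module Submission where

open import Defs
open import Data.List using (List; []; _∷_; _++_; map; [_])
open import Data.List.Properties using (map-∘)
open import Data.List.Relation.Unary.All as All using (All; []; _∷_; tabulate)
open import Data.List.Relation.Unary.All.Properties using (++⁺; ++⁻; ∷ʳ⁺; ∷ʳ⁻)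
open import Data.List.Relation.Unary.Any using (here; there)
open import Data.List.Membership.Propositional using (_∈_)
open import Data.List.Membership.Propositional.Properties using (∈-map⁺)
open import Data.List.Relation.Binary.Subset.Propositional using (_⊆_)
open import Data.List.Relation.Binary.Subset.Propositional.Properties
  using (⊆-refl; ⊆-trans; ⊆-reflexive-↭; All-resp-⊇; map⁺; xs⊆x∷xs; xs⊆xs++ys; ∷⁺ʳ; ∈-∷⁺ʳ; ++⁺ʳ)
open import Data.List.Relation.Binary.Permutation.Propositional using (↭-refl; ↭-swap)
import Data.List.Relation.Binary.Permutation.Propositional.Properties as ↭
open import Data.Nat using (zero; suc; s≤s)
open import Data.Product using (_×_; _,_; proj₁; proj₂)
open import Relation.Binary.PropositionalEquality using (_≡_; refl; sym; cong; subst)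

private
  variable
    A : Set
    x y : A
    xs ys : List A
    Ξ Ξ' Γ Γ' Δ Δ' Θ Θ' Γ₁ Δ₁ : List Formula
    φ ψ χ φ₁ φ₂ : Formula
    S S' S₁ S₂ : Sequent
    G H H' : Hyper
    c : Calc

⊆-contract : x ∷ x ∷ xs ⊆ x ∷ xs
⊆-contract = ∈-∷⁺ʳ (here refl) ⊆-refl

⊆-swap : ∀ (xs : List A) → xs ++ x ∷ y ∷ ys ⊆ xs ++ y ∷ x ∷ ys
⊆-swap xs = ⊆-reflexive-↭ (↭.++⁺ˡ xs (↭-swap _ _ ↭-refl))

weaken : Ξ ⊆ Ξ' → Ξ ⊢ φ → Ξ' ⊢ φ
weaken ρ (hyp m)    = hyp (ρ m)
weaken ρ (⊥E p)     = ⊥E (weaken ρ p)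
weaken ρ (∧I p q)   = ∧I (weaken ρ p) (weaken ρ q)
weaken ρ (∧E₁ p)    = ∧E₁ (weaken ρ p)
weaken ρ (∧E₂ p)    = ∧E₂ (weaken ρ p)
weaken ρ (∨I₁ p)    = ∨I₁ (weaken ρ p)
weaken ρ (∨I₂ p)    = ∨I₂ (weaken ρ p)
weaken ρ (∨E p q r) = ∨E (weaken ρ p) (weaken (∷⁺ʳ _ ρ) q) (weaken (∷⁺ʳ _ ρ) r)
weaken ρ (⇒I p)     = ⇒I (weaken (∷⁺ʳ _ ρ) p)
weaken ρ (⇒E p q)   = ⇒E (weaken ρ p) (weaken ρ q)
weaken ρ (∀I p)     = ∀I (weaken (map⁺ shiftF ρ) p)
weaken ρ (∀E p t)   = ∀E (weaken ρ p) t
weaken ρ (∃I t p)   = ∃I t (weaken ρ p)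
weaken ρ (∃E p q)   = ∃E (weaken ρ p) (weaken (∷⁺ʳ _ (map⁺ shiftF ρ)) q)
weaken ρ lin        = lin

weaken₁ : Ξ ⊢ φ → ψ ∷ Ξ ⊢ φ
weaken₁ = weaken (xs⊆x∷xs _ _)

weaken₁-under : φ ∷ Ξ ⊢ χ → φ ∷ ψ ∷ Ξ ⊢ χ
weaken₁-under = weaken (∷⁺ʳ _ (xs⊆x∷xs _ _))

hyp₀ : φ ∷ Ξ ⊢ φ
hyp₀ = hyp (here refl)

hyp₁ : ψ ∷ φ ∷ Ξ ⊢ φ
hyp₁ = hyp (there (here refl))

⊢-cut : Ξ ⊢ φ → φ ∷ Ξ ⊢ χ → Ξ ⊢ χ
⊢-cut p q = ⇒E (⇒I q) p

⋀-intro : All (Ξ ⊢_) Γ → Ξ ⊢ ⋀ Γ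
⋀-intro []           = ⇒I hyp₀
⋀-intro (p ∷ [])     = p
⋀-intro (p ∷ q ∷ ps) = ∧I p (⋀-intro (q ∷ ps))

⋀-elim : ∀ Γ → Ξ ⊢ ⋀ Γ → All (Ξ ⊢_) Γ
⋀-elim []          p = []
⋀-elim (φ ∷ [])    p = p ∷ []
⋀-elim (φ ∷ ψ ∷ Γ) p = ∧E₁ p ∷ ⋀-elim (ψ ∷ Γ) (∧E₂ p)

⋁-intro : φ ∈ Δ → Ξ ⊢ φ → Ξ ⊢ ⋁ Δ
⋁-intro {Δ = φ ∷ []}    (here refl) p = p
⋁-intro {Δ = φ ∷ ψ ∷ Δ} (here refl) p = ∨I₁ p
⋁-intro {Δ = φ ∷ ψ ∷ Δ} (there m)   p = ∨I₂ (⋁-intro m p)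

⋁-elim : Ξ ⊢ ⋁ Δ → All (λ δ → δ ∷ Ξ ⊢ χ) Δ → Ξ ⊢ χ
⋁-elim p []            = ⊥E p
⋁-elim p (k ∷ [])      = ⊢-cut p k
⋁-elim p (k ∷ k' ∷ ks) = ∨E p k (⋁-elim hyp₀ (All.map weaken₁-under (k' ∷ ks)))

substF-⋀ : ∀ σ Γ → substF σ (⋀ Γ) ≡ ⋀ (map (substF σ) Γ)
substF-⋀ σ []          = refl
substF-⋀ σ (φ ∷ [])    = refl
substF-⋀ σ (φ ∷ ψ ∷ Γ) = cong (substF σ φ ∧ᶠ_) (substF-⋀ σ (ψ ∷ Γ))

substF-⋁ : ∀ σ Δ → substF σ (⋁ Δ) ≡ ⋁ (map (substF σ) Δ)
substF-⋁ σ []          = refl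
substF-⋁ σ (φ ∷ [])    = refl
substF-⋁ σ (φ ∷ ψ ∷ Δ) = cong (substF σ φ ∨ᶠ_) (substF-⋁ σ (ψ ∷ Δ))

⟦_⟧ˢ : Sequent → Formula
⟦ S ⟧ˢ = ⋀ (ante S) ⇒ᶠ ⋁ (succ S)

-- Elimination-style forms of Ξ ⊢ ⟦ S ⟧ˢ and Ξ ⊢ ⋁ (map ⟦_⟧ˢ H), interderivable with them.
-- Unlike ⋀ and ⋁ they are injective in S and H, so the sequents of a rule instance are
-- found by unification; quantifying over Ξ' ⊇ Ξ is what lets ⊢ˢ⇒⊢⟦⟧ assume ⋀ Γ.
infix 2 _⊢ˢ_ _⊢ʰ_

_⊢ˢ_ : List Formula → Sequent → Set
Ξ ⊢ˢ S = ∀ {Ξ' χ} → Ξ ⊆ Ξ' → All (Ξ' ⊢_) (ante S) → All (λ δ → δ ∷ Ξ' ⊢ χ) (succ S) → Ξ' ⊢ χ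

_⊢ʰ_ : List Formula → Hyper → Set
Ξ ⊢ʰ H = ∀ {χ} → All (λ S → ⟦ S ⟧ˢ ∷ Ξ ⊢ χ) H → Ξ ⊢ χ

⊢ˢ⇒⊢⟦⟧ : Ξ ⊢ˢ S → Ξ ⊢ ⟦ S ⟧ˢ
⊢ˢ⇒⊢⟦⟧ {S = Γ ⇒ Δ} p = ⇒I (p (xs⊆x∷xs _ _) (⋀-elim Γ hyp₀) (tabulate (λ m → ⋁-intro m hyp₀)))

⊢⟦⟧⇒⊢ˢ : Ξ ⊢ ⟦ S ⟧ˢ → Ξ ⊢ˢ S
⊢⟦⟧⇒⊢ˢ p ρ as ks = ⋁-elim (⇒E (weaken ρ p) (⋀-intro as)) ks

⊢ʰ⇒⊢⋁ : Ξ ⊢ʰ H → Ξ ⊢ ⋁ (map ⟦_⟧ˢ H)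
⊢ʰ⇒⊢⋁ p = p (tabulate (λ m → ⋁-intro (∈-map⁺ ⟦_⟧ˢ m) hyp₀))

⊢⟦⟧⇒⊢ʰ : Ξ ⊢ ⟦ S ⟧ˢ → Ξ ⊢ʰ [ S ]
⊢⟦⟧⇒⊢ʰ p (k ∷ []) = ⊢-cut p k

⊢ˢ-mono : Γ ⊆ Γ' → Δ ⊆ Δ' → Ξ ⊢ˢ Γ ⇒ Δ → Ξ ⊢ˢ Γ' ⇒ Δ'
⊢ˢ-mono Γ⊆Γ' Δ⊆Δ' p ρ as ks = p ρ (All-resp-⊇ Γ⊆Γ' as) (All-resp-⊇ Δ⊆Δ' ks)

⊢ˢ-head : (∀ {Ξ} → Ξ ⊢ φ → Ξ ⊢ ψ) → Ξ ⊢ˢ ψ ∷ Γ ⇒ Δ → Ξ ⊢ˢ φ ∷ Γ ⇒ Δ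
⊢ˢ-head f p ρ (a ∷ as) ks = p ρ (f a ∷ as) ks

⊢ˢ-last : ∀ Δ → (∀ {Ξ} → Ξ ⊢ φ → Ξ ⊢ ψ) → Ξ ⊢ˢ Γ ⇒ Δ ++ [ φ ] → Ξ ⊢ˢ Γ ⇒ Δ ++ [ ψ ]
⊢ˢ-last Δ f p ρ as ks =
  let ksΔ , k = ∷ʳ⁻ {xs = Δ} ks
  in p ρ as (∷ʳ⁺ ksΔ (⊢-cut (f hyp₀) (weaken₁-under k)))

⊢ˢ-continuation : Ξ ⊢ˢ φ ∷ Γ ⇒ Δ → Ξ ⊆ Ξ' → All (Ξ' ⊢_) Γ → All (λ δ → δ ∷ Ξ' ⊢ χ) Δ → φ ∷ Ξ' ⊢ χ
⊢ˢ-continuation p ρ as ks =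
  p (⊆-trans ρ (xs⊆x∷xs _ _)) (hyp₀ ∷ All.map weaken₁ as) (All.map weaken₁-under ks)

⊢ˢ-cut : ∀ Γ₀ Δ₀ → Ξ ⊢ˢ Γ₀ ⇒ Δ₀ ++ [ φ ] → Ξ ⊢ˢ φ ∷ Γ₁ ⇒ Δ₁ → Ξ ⊢ˢ Γ₀ ++ Γ₁ ⇒ Δ₀ ++ Δ₁
⊢ˢ-cut Γ₀ Δ₀ p q ρ as ks =
  let as₀ , as₁ = ++⁻ Γ₀ as
      ks₀ , ks₁ = ++⁻ Δ₀ ks
  in p ρ as₀ (∷ʳ⁺ ks₀ (⊢ˢ-continuation q ρ as₁ ks₁))

⊢ˢ-∧R : ∀ Δ → Ξ ⊢ˢ Γ ⇒ Δ ++ [ φ₁ ] → Ξ ⊢ˢ Γ ⇒ Δ ++ [ φ₂ ] → Ξ ⊢ˢ Γ ⇒ Δ ++ [ φ₁ ∧ᶠ φ₂ ]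
⊢ˢ-∧R Δ p q ρ as ks =
  let ksΔ , k = ∷ʳ⁻ {xs = Δ} ks
      k₂ = ⊢-cut (∧I hyp₁ hyp₀) (weaken (∷⁺ʳ _ (λ m → there (there m))) k)
      k₁ = q (⊆-trans ρ (xs⊆x∷xs _ _)) (All.map weaken₁ as) (∷ʳ⁺ (All.map weaken₁-under ksΔ) k₂)
  in p ρ as (∷ʳ⁺ ksΔ k₁)

⊢ˢ-∨L : Ξ ⊢ˢ φ₁ ∷ Γ ⇒ Δ → Ξ ⊢ˢ φ₂ ∷ Γ ⇒ Δ → Ξ ⊢ˢ φ₁ ∨ᶠ φ₂ ∷ Γ ⇒ Δ
⊢ˢ-∨L p q ρ (a ∷ as) ks = ∨E a (⊢ˢ-continuation p ρ as ks) (⊢ˢ-continuation q ρ as ks)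

⊢ˢ-⇒L : Ξ ⊢ˢ Γ ⇒ Δ ++ [ φ ] → Ξ ⊢ˢ ψ ∷ Γ ⇒ Δ → Ξ ⊢ˢ φ ⇒ᶠ ψ ∷ Γ ⇒ Δ
⊢ˢ-⇒L p q ρ (i ∷ as) ks =
  p ρ as (∷ʳ⁺ ks (⊢-cut (⇒E (weaken₁ i) hyp₀) (weaken₁-under (⊢ˢ-continuation q ρ as ks))))

⊢ˢ-⇒R : Ξ ⊢ˢ φ ∷ Γ ⇒ [ ψ ] → Ξ ⊢ˢ Γ ⇒ [ φ ⇒ᶠ ψ ]
⊢ˢ-⇒R p ρ as (k ∷ []) = ⊢-cut (⇒I (⊢ˢ-continuation p ρ as (hyp₀ ∷ []))) k

⊢ˢ-replaceˡ : ∀ Γ Δ Δ' → Ξ ⊢ ⋀ Δ ⇒ᶠ ⋀ Δ' → Ξ ⊢ˢ Γ ++ Δ' ⇒ Θ → Ξ ⊢ˢ Γ ++ Δ ⇒ Θ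
⊢ˢ-replaceˡ Γ Δ Δ' i p ρ as ks =
  let asΓ , asΔ = ++⁻ Γ as
  in p ρ (++⁺ asΓ (⋀-elim Δ' (⇒E (weaken ρ i) (⋀-intro asΔ)))) ks

⊢ʰ-mono : H ⊆ H' → Ξ ⊢ʰ H → Ξ ⊢ʰ H'
⊢ʰ-mono H⊆H' p ks = p (All-resp-⊇ H⊆H' ks)

⊢ʰ-∨E : Ξ ⊢ φ ∨ᶠ ψ → φ ∷ Ξ ⊢ʰ H → ψ ∷ Ξ ⊢ʰ H → Ξ ⊢ʰ H
⊢ʰ-∨E o p q ks = ∨E o (p (All.map weaken₁-under ks)) (q (All.map weaken₁-under ks))

⊢ʰ-cut : Ξ ⊢ʰ S ∷ G → ⟦ S ⟧ˢ ∷ Ξ ⊢ʰ S' ∷ G → Ξ ⊢ʰ S' ∷ G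
⊢ʰ-cut p q (k ∷ ks) = p (q (All.map weaken₁-under (k ∷ ks)) ∷ ks)

⊢ʰ-active : (∀ {Ξ'} → Ξ ⊆ Ξ' → Ξ' ⊢ˢ S → Ξ' ⊢ˢ S') → Ξ ⊢ʰ S ∷ G → Ξ ⊢ʰ S' ∷ G
⊢ʰ-active f p (k ∷ ks) = p (⊢-cut (⊢ˢ⇒⊢⟦⟧ (f (xs⊆x∷xs _ _) (⊢⟦⟧⇒⊢ˢ hyp₀))) (weaken₁-under k) ∷ ks)

⊢ʰ-active₁ : (∀ {Ξ} → Ξ ⊢ˢ S → Ξ ⊢ˢ S') → Ξ ⊢ʰ S ∷ G → Ξ ⊢ʰ S' ∷ G
⊢ʰ-active₁ f = ⊢ʰ-active (λ _ → f)

⊢ʰ-active₂ : (∀ {Ξ} → Ξ ⊢ˢ S₁ → Ξ ⊢ˢ S₂ → Ξ ⊢ˢ S') →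
             (∀ {Ξ} → Ξ ⊢ʰ S₁ ∷ G) → (∀ {Ξ} → Ξ ⊢ʰ S₂ ∷ G) → Ξ ⊢ʰ S' ∷ G
⊢ʰ-active₂ f p q = ⊢ʰ-cut p (⊢ʰ-active (λ ρ → f (⊢⟦⟧⇒⊢ˢ (hyp (ρ (here refl))))) q)

⊢ʰ-com : ∀ Γ Δ Γ' Δ' →
         (∀ {Ξ} → Ξ ⊢ʰ (Γ ++ Δ ⇒ Θ) ∷ G) → (∀ {Ξ} → Ξ ⊢ʰ (Γ' ++ Δ' ⇒ Θ') ∷ G) →
         Ξ ⊢ʰ (Γ ++ Δ' ⇒ Θ) ∷ (Γ' ++ Δ ⇒ Θ') ∷ G
⊢ʰ-com Γ Δ Γ' Δ' p q =
  ⊢ʰ-∨E (lin {φ = ⋀ Δ} {ψ = ⋀ Δ'})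
    (⊢ʰ-mono (xs⊆x∷xs _ _) (⊢ʰ-active (λ ρ → ⊢ˢ-replaceˡ Γ' Δ Δ' (hyp (ρ (here refl)))) q))
    (⊢ʰ-mono (∷⁺ʳ _ (xs⊆x∷xs _ _)) (⊢ʰ-active (λ ρ → ⊢ˢ-replaceˡ Γ Δ' Δ (hyp (ρ (here refl)))) p))

⊢ʰ-∀R : (∀ {Ξ} → Ξ ⊢ʰ [ map shiftF Γ ⇒ [ φ ] ]) → Ξ ⊢ʰ [ Γ ⇒ [ ∀ᶠ φ ] ]
⊢ʰ-∀R {Γ = Γ} p =
  ⊢⟦⟧⇒⊢ʰ (⇒I (∀I (⇒E (⊢ʰ⇒⊢⋁ p) (subst (_⊢_ _) (substF-⋀ _ Γ) hyp₀))))

⊢ʰ-∃L : (∀ {Ξ} → Ξ ⊢ʰ [ φ ∷ map shiftF Γ ⇒ map shiftF Δ ]) → Ξ ⊢ʰ [ ∃ᶠ φ ∷ Γ ⇒ Δ ]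
⊢ʰ-∃L {φ = φ} {Γ = Γ} {Δ = Δ} {Ξ = Ξ} p =
  ⊢⟦⟧⇒⊢ʰ (⇒I (∃E witness (subst (_⊢_ _) (sym (substF-⋁ _ Δ)) body)))
  where
  witness : ⋀ (∃ᶠ φ ∷ Γ) ∷ Ξ ⊢ ∃ᶠ φ
  witness = All.head (⋀-elim (∃ᶠ φ ∷ Γ) hyp₀)

  shifted-Γ : All (φ ∷ map shiftF (⋀ (∃ᶠ φ ∷ Γ) ∷ Ξ) ⊢_) (map shiftF Γ)
  shifted-Γ = All.tail (⋀-elim (map shiftF (∃ᶠ φ ∷ Γ))
                               (weaken₁ (subst (_⊢_ _) (substF-⋀ _ (∃ᶠ φ ∷ Γ)) hyp₀)))

  body : φ ∷ map shiftF (⋀ (∃ᶠ φ ∷ Γ) ∷ Ξ) ⊢ ⋁ (map shiftF Δ)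
  body = ⇒E (⊢ʰ⇒⊢⋁ p) (⋀-intro (hyp₀ ∷ shifted-Γ))

soundness : Der c H → Ξ ⊢ʰ H
soundness (ax _)                  = ⊢⟦⟧⇒⊢ʰ (⇒I hyp₀)
soundness (ax⊥ _)                 = ⊢⟦⟧⇒⊢ʰ (⇒I (⊥E hyp₀))
soundness (ew _ d)                = ⊢ʰ-mono (xs⊆x∷xs _ _) (soundness d)
soundness (ec _ d)                = ⊢ʰ-mono ⊆-contract (soundness d)
soundness (ee {G} _ d)            = ⊢ʰ-mono (⊆-swap G) (soundness d)
soundness (wl _ d)                = ⊢ʰ-active₁ (⊢ˢ-mono (xs⊆x∷xs _ _) ⊆-refl) (soundness d)
soundness (wr {Δ = Δ} _ d)        = ⊢ʰ-active₁ (⊢ˢ-mono ⊆-refl (xs⊆xs++ys Δ _)) (soundness d)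
soundness (cl _ d)                = ⊢ʰ-active₁ (⊢ˢ-mono ⊆-contract ⊆-refl) (soundness d)
soundness (cr {Δ = Δ} _ d)        = ⊢ʰ-active₁ (⊢ˢ-mono ⊆-refl (++⁺ʳ Δ ⊆-contract)) (soundness d)
soundness (xl {Γ = Γ} _ d)        = ⊢ʰ-active₁ (⊢ˢ-mono (⊆-swap Γ) ⊆-refl) (soundness d)
soundness (xr {Δ = Δ} _ d)        = ⊢ʰ-active₁ (⊢ˢ-mono ⊆-refl (⊆-swap Δ)) (soundness d)
soundness (cut {Γ₀} {Δ₀} _ d e)   = ⊢ʰ-active₂ (⊢ˢ-cut Γ₀ Δ₀) (soundness d) (soundness e)
soundness (∧L₁ _ d)               = ⊢ʰ-active₁ (⊢ˢ-head ∧E₁) (soundness d)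
soundness (∧L₂ _ d)               = ⊢ʰ-active₁ (⊢ˢ-head ∧E₂) (soundness d)
soundness (∧R {Δ = Δ} _ d e)      = ⊢ʰ-active₂ (⊢ˢ-∧R Δ) (soundness d) (soundness e)
soundness (∨L _ d e)              = ⊢ʰ-active₂ ⊢ˢ-∨L (soundness d) (soundness e)
soundness (∨R₁ {Δ = Δ} _ d)       = ⊢ʰ-active₁ (⊢ˢ-last Δ ∨I₁) (soundness d)
soundness (∨R₂ {Δ = Δ} _ d)       = ⊢ʰ-active₁ (⊢ˢ-last Δ ∨I₂) (soundness d)
soundness (⇒L _ d e)              = ⊢ʰ-active₂ ⊢ˢ-⇒L (soundness d) (soundness e)
-- HLK's ⇒R is intuitionistically unsound for nonempty Δ; in ∀HLJ the single-conclusion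
-- side condition rules that out.
soundness (⇒R {Δ = []} _ _ d)     = ⊢ʰ-active₁ ⊢ˢ-⇒R (soundness d)
soundness (⇒R {Δ = _ ∷ []} refl (s≤s () ∷ _) _)
soundness (⇒R {Δ = _ ∷ _ ∷ _} refl (s≤s () ∷ _) _)
soundness (⇒R' _ _ d)             = ⊢ʰ-active₁ ⊢ˢ-⇒R (soundness d)
soundness (∀L t _ d)              = ⊢ʰ-active₁ (⊢ˢ-head (λ p → ∀E p t)) (soundness d)
soundness (∀R _ d)                = ⊢ʰ-∀R (soundness d)
soundness (∃L _ d)                = ⊢ʰ-∃L (soundness d)
soundness (∃R {Δ = Δ} t _ d)      = ⊢ʰ-active₁ (⊢ˢ-last Δ (∃I t)) (soundness d)
soundness (com {Γ} {Δ} {_} {Γ'} {Δ'} _ d e) = ⊢ʰ-com Γ Δ Γ' Δ' (soundness d) (soundness e)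

Valid-closeN : ∀ k → Valid φ → Valid (closeN k φ)
Valid-closeN zero    p = p
Valid-closeN (suc k) p = ∀I (Valid-closeN k p)

closure-valid : ∀ H → Der c H → Valid (closure (⋁ (map ⟦_⟧ˢ H)))
closure-valid _ d = Valid-closeN _ (⊢ʰ⇒⊢⋁ (soundness d))

mainTheorem7 :
    ((H : List (List Formula × Formula)) →
      Der J (map (λ p → proj₁ p ⇒ [ proj₂ p ]) H) →
      Valid (closure (⋁ (map (λ p → ⋀ (proj₁ p) ⇒ᶠ proj₂ p) H))))
    ×
    ((H : Hyper) →
      Der J' H →
      Valid (closure (⋁ (map (λ S → ⋀ (ante S) ⇒ᶠ ⋁ (succ S)) H))))
mainTheorem7 =
    (λ H d → subst (λ Φ → Valid (closure (⋁ Φ))) (sym (map-∘ H)) (closure-valid _ d))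
  , closure-valid
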